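{- Let $\mathbf{x}\in\{0,1\}^m$. If $H(\mathbf{x})=0$, then $P_{12}(\mathbf{x})=0$.
   Context: $\mathcal{N}$ is a rooted binary phylogenetic network on a finite set $X$ with vertices $v_0,\dots,v_{n_{\mathcal{N}}-1}$. That is, $\mathcal{N}$ is an acyclic digraph without parallel edges with a unique root (in-degree 0, out-degree 2, reaching all vertices), leaves of in-degree 1 forming $X$, and other vertices of in/out-degree $(1,2)$ or $(2,1)$. $\mathcal{T}$ is a rooted binary phylogenetic $X$-tree (no in-degree-2 vertices) with vertices $u_0,\dots,u_{n_{\mathcal{T}}-1}$, $u_0$ its root. Assume $n_{\mathcal{N}}\ge n_{\mathcal{T}}$, and let $s=1+\lfloor\log_2(n_{\mathcal{N}}-n_{\mathcal{T}})\rfloor$ if $n_{\mathcal{N}}>n_{\mathcal{T}}$ and $s=0$ otherwise. Tree vertices have out-degree 2, with children $v_{j_1},v_{j_2}$. Reticulation vertices have in-degree 2, with parents $v_{j^1},v_{j^2}$. $f(u_i,u_l)=1$ iff $(u_i,u_l)\in E(\mathcal{T})$, and $g(v_j,v_k)=1$ iff $(v_j,v_k)\in E(\mathcal{N})$. $\ell(i)$ is the index of the leaf of $\mathcal{N}$ labeled like leaf $u_i$ of $\mathcal{T}$. The binary variables (forming $\mathbf{x}\in\{0,1\}^m$) are: - $x_{i,j}$ ($0\le i\le n_{\mathcal{T}}$, $0\le j<n_{\mathcal{N}}$); - $y_{i,r}$ ($1\le i<n_{\mathcal{T}}$, $0\le r<s$); - $z_{i,j}$ ($i<n_{\mathcal{T}}$,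 $v_j$ tree or reticulation); - $\hat z_{i,2j},\hat z_{i,2j+1}$ ($u_i$ non-leaf, $v_j$ tree). With $i,l\in\{0,\dots,n_{\mathcal{T}}-1\}$ and $j,k\in\{0,\dots,n_{\mathcal{N}}-1\}$: - $P_1=(1-\sum_jx_{0,j})^2+\sum_{i=1}^{n_{\mathcal{T}}-1}(1-\sum_jx_{i,j}+\sum_{r=0}^{s-1}2^ry_{i,r})^2$; - $P_2=\sum_j(\sum_{i=0}^{n_{\mathcal{T}}}x_{i,j}-1)^2$; - $P_3=\sum_i\sum_{\text{tree }v_j}(x_{i,j_1}x_{i,j_2}-2x_{i,j_1}z_{i,j}-2x_{i,j_2}z_{i,j}+3z_{i,j})$; - $P_4=\sum_i\sum_{\text{tree }v_j}x_{i,j}z_{i,j}$; - $P_5=\sum_i\sum_{\text{ret. }v_j}(x_{i,j^1}x_{i,j^2}-2x_{i,j^1}z_{i,j}-2x_{i,j^2}z_{i,j}+3z_{i,j})$; - $P_6=\sum_i\sum_{\text{ret. }v_j}x_{i,j}z_{i,j}$; - $P_7=\sum_i\sum_{l\ne i}f(u_i,u_l)\sum_{\text{tree }v_j}x_{i,j}z_{l,j}$; - $P_8=\sum_{u_i\text{ non-leaf}}\sum_{\text{tree }v_j}(x_{i,j}x_{i,j_1}-2x_{i,j}\hat z_{i,2j}-2x_{i,j_1}\hat z_{i,2j}+3\hat z_{i,2j}+x_{i,j}x_{i,j_2}-2x_{i,j}\hat z_{i,2j+1}-2x_{i,j_2}\hat z_{i,2j+1}+3\hat z_{i,2j+1})$;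 - $P_9=\sum_i\sum_{l\ne i}f(u_i,u_l)\sum_{\text{tree }v_j}(\hat z_{i,2j}x_{l,j_2}+\hat z_{i,2j+1}x_{l,j_1})$; - $P_{10}=\sum_{u_i\text{ leaf}}(1-x_{i,\ell(i)})^2$; - $P_{11}=\sum_i\sum_jx_{i,j}(1-\sum_{k\ne j}g(v_j,v_k)x_{i,k})-n_{\mathcal{T}}$; - $P_{12}=\sum_i\sum_{l\ne i}f(u_i,u_l)(1-\sum_j\sum_{k\ne j}g(v_j,v_k)x_{i,j}x_{l,k})$. Finally, $H=B\sum_{I=1}^{10}P_I+AP_{11}+P_{12}$ with $A=2n_{\mathcal{N}}$ and $B=4n_{\mathcal{N}}^2n_{\mathcal{T}}^2$. -}

module Defs where

open import Data.Bool using (Bool; true; false; if_then_else_; not; _∧_)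
open import Data.Nat as ℕ using (ℕ; zero; suc; _≡ᵇ_; _<ᵇ_; _∸_)
open import Data.Nat.Logarithm using (⌊log₂_⌋)
open import Data.Integer as ℤ using (ℤ; +_; _+_; _-_; _*_)
open import Data.Fin using (Fin; toℕ; inject₁; _≟_)
open import Data.List using (List; []; _∷_; filterᵇ; allFin)
open import Data.Product using (_×_; ∃)
open import Data.Sum using (_⊎_)
open import Relation.Nullary using (¬_)
open import Relation.Nullary.Decidable using (⌊_⌋)
open import Relation.Binary.PropositionalEquality using (_≡_; _≢_)
open import Function.Bundles using (_⇔_)
open import Function.Definitions using (Injective)

sumℕ : ∀ {n} → (Fin n → ℕ) → ℕ
sumℕ {zero}  f = 0
sumℕ {suc n} f = f Data.Fin.zero ℕ.+ sumℕ (λ i → f (Data.Fin.suc i))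

Σ : ∀ {n} → (Fin n → ℤ) → ℤ
Σ {zero}  f = + 0
Σ {suc n} f = f Data.Fin.zero + Σ (λ i → f (Data.Fin.suc i))

-- Digraphs on vertex set Fin n, given by a Boolean edge relation
-- (E j k ≡ true  iff  (v_j , v_k) is an edge; no parallel edges possible)

Graph : ℕ → Set
Graph n = Fin n → Fin n → Bool

b2ℕ : Bool → ℕ
b2ℕ true  = 1
b2ℕ false = 0

outdeg : ∀ {n} → Graph n → Fin n → ℕ
outdeg E j = sumℕ (λ k → b2ℕ (E j k))

indeg : ∀ {n} → Graph n → Fin n → ℕ
indeg E j = sumℕ (λ k → b2ℕ (E k j))

data Path {n} (E : Graph n) : Fin n → Fin n → Set where
  edge : ∀ {j k} → E j k ≡ true → Path E j k
  step : ∀ {j k l} → E j k ≡ true → Path E k l → Path E j l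

record IsPhyloNetwork {n p : ℕ} (E : Graph n) (lab : Fin p → Fin n) : Set where
  field
    root         : Fin n
    root-indeg   : indeg E root ≡ 0
    root-outdeg  : outdeg E root ≡ 2
    root-reaches : ∀ k → k ≡ root ⊎ Path E root k
    acyclic      : ∀ j → ¬ Path E j j
    degrees      : ∀ j → j ≢ root →
                     (indeg E j ≡ 1 × outdeg E j ≡ 0)
                   ⊎ (indeg E j ≡ 1 × outdeg E j ≡ 2)
                   ⊎ (indeg E j ≡ 2 × outdeg E j ≡ 1)
    lab-injective : Injective _≡_ _≡_ lab
    lab-leaves    : ∀ j → (indeg E j ≡ 1 × outdeg E j ≡ 0) ⇔ ∃ (λ a → lab a ≡ j)

record IsPhyloTree {n p : ℕ} (E : Graph n) (lab : Fin p → Fin n) : Set where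
  field
    network      : IsPhyloNetwork E lab
    no-reticulation : ∀ j → ¬ (indeg E j ≡ 2)
    root-is-u₀   : toℕ (IsPhyloNetwork.root network) ≡ 0

outs : ∀ {n} → Graph n → Fin n → List (Fin n)
outs {n} E j = filterᵇ (λ k → E j k) (allFin n)

ins : ∀ {n} → Graph n → Fin n → List (Fin n)
ins {n} E j = filterᵇ (λ k → E k j) (allFin n)

first : ∀ {A : Set} → List A → A → A
first []      d = d
first (a ∷ _) d = a

second : ∀ {A : Set} → List A → A → A
second (_ ∷ b ∷ _) d = b
second _           d = d

-- j₁, j₂ (children of a tree vertex) and j¹, j² (parents of a reticulation)
child₁ child₂ parent₁ parent₂ : ∀ {n} → Graph n → Fin n → Fin n
child₁  E j = first  (outs E j) j
child₂  E j = second (outs E j) j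
parent₁ E j = first  (ins E j) j
parent₂ E j = second (ins E j) j

isTreeV isRetV isLeaf : ∀ {n} → Graph n → Fin n → Bool
isTreeV E j = outdeg E j ≡ᵇ 2
isRetV  E j = indeg E j ≡ᵇ 2
isLeaf  E j = (indeg E j ≡ᵇ 1) ∧ (outdeg E j ≡ᵇ 0)

sOf : ℕ → ℕ → ℕ
sOf nN nT = if nT <ᵇ nN then suc ⌊log₂ (nN ∸ nT) ⌋ else 0

-- Binary variables (the vector x ∈ {0,1}^m, organised by index family).
-- zh₀ i j = ẑ_{i,2j}, zh₁ i j = ẑ_{i,2j+1}.  Entries at indices that do
-- not correspond to variables (e.g. y_{0,r}, z_{i,j} for v_j a leaf)
-- never occur in H or P₁₂.

record Vars (nT nN s : ℕ) : Set where
  field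
    x   : Fin (suc nT) → Fin nN → Bool
    y   : Fin nT → Fin s → Bool
    z   : Fin nT → Fin nN → Bool
    zh₀ : Fin nT → Fin nN → Bool
    zh₁ : Fin nT → Fin nN → Bool

⟦_⟧ : Bool → ℤ
⟦ true ⟧  = + 1
⟦ false ⟧ = + 0

[_]·_ : Bool → ℤ → ℤ
[ b ]· t = if b then t else + 0

sq : ℤ → ℤ
sq a = a * a

module QUBO {nN nT s : ℕ} (EN : Graph nN) (ET : Graph nT)
            (ℓ : Fin nT → Fin nN) (v : Vars nT nN s) where
  open Vars v

  X : Fin nT → Fin nN → ℤ
  X i j = ⟦ x (inject₁ i) j ⟧
  Z : Fin nT → Fin nN → ℤ
  Z i j = ⟦ z i j ⟧
  F : Fin nT → Fin nT → ℤ
  F i l = ⟦ ET i l ⟧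
  G : Fin nN → Fin nN → ℤ
  G j k = ⟦ EN j k ⟧
  tree ret : Fin nN → Bool
  tree = isTreeV EN
  ret  = isRetV EN
  j₁ j₂ j¹ j² : Fin nN → Fin nN
  j₁ = child₁ EN
  j₂ = child₂ EN
  j¹ = parent₁ EN
  j² = parent₂ EN
  neq : ∀ {m} → Fin m → Fin m → Bool
  neq a b = not ⌊ a ≟ b ⌋

  P₁ P₂ P₃ P₄ P₅ P₆ P₇ P₈ P₉ P₁₀ P₁₁ P₁₂ H : ℤ
  P₁ = sq (+ 1 - Σ (λ j → ⟦ x Data.Fin.zero j ⟧))
     + Σ (λ i → [ not (toℕ i ≡ᵇ 0) ]·
          sq (+ 1 - Σ (λ j → X i j) + Σ (λ r → + (2 ℕ.^ toℕ r) * ⟦ y i r ⟧)))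
  P₂ = Σ (λ j → sq (Σ (λ (i : Fin (suc nT)) → ⟦ x i j ⟧) - + 1))
  P₃ = Σ (λ i → Σ (λ j → [ tree j ]·
          (X i (j₁ j) * X i (j₂ j) - + 2 * X i (j₁ j) * Z i j
           - + 2 * X i (j₂ j) * Z i j + + 3 * Z i j)))
  P₄ = Σ (λ i → Σ (λ j → [ tree j ]· (X i j * Z i j)))
  P₅ = Σ (λ i → Σ (λ j → [ ret j ]·
          (X i (j¹ j) * X i (j² j) - + 2 * X i (j¹ j) * Z i j
           - + 2 * X i (j² j) * Z i j + + 3 * Z i j)))
  P₆ = Σ (λ i → Σ (λ j → [ ret j ]· (X i j * Z i j)))
  P₇ = Σ (λ i → Σ (λ l → [ neq l i ]· (F i l *
          Σ (λ j → [ tree j ]· (X i j * Z l j)))))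
  P₈ = Σ (λ i → [ not (isLeaf ET i) ]· Σ (λ j → [ tree j ]·
          (X i j * X i (j₁ j) - + 2 * X i j * ⟦ zh₀ i j ⟧
           - + 2 * X i (j₁ j) * ⟦ zh₀ i j ⟧ + + 3 * ⟦ zh₀ i j ⟧
           + X i j * X i (j₂ j) - + 2 * X i j * ⟦ zh₁ i j ⟧
           - + 2 * X i (j₂ j) * ⟦ zh₁ i j ⟧ + + 3 * ⟦ zh₁ i j ⟧)))
  P₉ = Σ (λ i → Σ (λ l → [ neq l i ]· (F i l *
          Σ (λ j → [ tree j ]·
             (⟦ zh₀ i j ⟧ * X l (j₂ j) + ⟦ zh₁ i j ⟧ * X l (j₁ j))))))
  P₁₀ = Σ (λ i → [ isLeaf ET i ]· sq (+ 1 - X i (ℓ i)))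
  P₁₁ = Σ (λ i → Σ (λ j → X i j *
          (+ 1 - Σ (λ k → [ neq k j ]· (G j k * X i k))))) - + nT
  P₁₂ = Σ (λ i → Σ (λ l → [ neq l i ]· (F i l *
          (+ 1 - Σ (λ j → Σ (λ k → [ neq k j ]· (G j k * X i j * X l k)))))))

  A B : ℤ
  A = + (2 ℕ.* nN)
  B = + (4 ℕ.* nN ℕ.* nN ℕ.* nT ℕ.* nT)

  H = B * (P₁ + P₂ + P₃ + P₄ + P₅ + P₆ + P₇ + P₈ + P₉ + P₁₀) + A * P₁₁ + P₁₂

-- H = B·S + A·P₁₁ + P₁₂ with S = P₁ + ⋯ + P₁₀ ≥ 0. Crude bounds P₁₁ ≥ −(n_T n_N + n_T) and
-- P₁₂ ≥ −2 n_N n_T² give A·P₁₁ + P₁₂ > −B, so H = 0 forces S = 0, and in particular P₂ = 0: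
-- every vertex of N is hit by exactly one row of x. Then P₁₂ is at least minus the number of
-- edges of N, which is < 2 n_N since the root has in-degree 0, and at most the number of edges
-- of T, which is < 2 n_T ≤ 2 n_N. So P₁₂ = −A·P₁₁ is a multiple of A = 2 n_N strictly between
-- −A and A, hence 0.

module Submission where

open import Defs
open import Data.Nat using (ℕ; _≤_)
open import Data.Integer using (ℤ; +_)
open import Data.Fin using (Fin)
open import Relation.Binary.PropositionalEquality using (_≡_)

open import Function using (_∘_)
open import Data.Bool using (Bool; true; false)
open import Data.Product using (_×_; _,_; proj₁; proj₂)
open import Data.Sum using (inj₁; inj₂; reduce)
open import Data.Empty using (⊥-elim)
open import Relation.Nullary using (yes; no; contradiction)
open import Relation.Binary.PropositionalEquality using (refl; sym; trans; cong; cong₂; subst)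
open import Data.Fin using (zero; suc; inject₁; fromℕ; toℕ; _≟_)
import Data.Nat as ℕ
import Data.Nat.Properties as ℕ
open import Data.Integer
  using (-[1+_]; 0ℤ; -_; _+_; _*_; _-_; +≤+; +<+; -≤+)
  renaming (_≤_ to _≤ᶻ_; _<_ to _<ᶻ_)
open import Data.Integer.Properties
  using ( ≤-refl; ≤-trans; ≤-antisym; <-≤-trans; ≤-<-trans; <-irrefl; ≤⇒≯
        ; +-mono-≤; +-monoʳ-≤; +-monoˡ-≤; +-monoʳ-<; neg-mono-≤; neg-mono-<
        ; *-identityˡ; *-identityʳ; *-zeroʳ; +-identityˡ; +-assoc; +-inverseʳ
        ; neg-distrib-+; neg-distribʳ-*; pos-*; i-j≡0⇒i≡j
        ; *-monoˡ-≤-nonNeg; i≤i+j; i≤j+i; i-j≤i; i*j≡0⇒i≡0∨j≡0; +-*-semiring )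
open import Data.Integer.Base using (nonNegative)
open import Algebra.Properties.Semiring.Sum +-*-semiring
  using (sum; sum-cong-≗; ∑-comm; *-distribˡ-sum; sum-init-last)
open import Algebra.Properties.AbelianGroup Data.Integer.Properties.+-0-abelianGroup using (inverseʳ-unique)
open import Data.Integer.Tactic.RingSolver using (solve-∀)
import Data.Nat.Tactic.RingSolver as ℕ-Solver

⟦⟧-nonneg : ∀ b → 0ℤ ≤ᶻ ⟦ b ⟧
⟦⟧-nonneg true  = +≤+ ℕ.z≤n
⟦⟧-nonneg false = +≤+ ℕ.z≤n

⟦⟧≡+b2ℕ : ∀ b → ⟦ b ⟧ ≡ + b2ℕ b
⟦⟧≡+b2ℕ true  = refl
⟦⟧≡+b2ℕ false = refl

b2ℕ≤1 : ∀ b → b2ℕ b ℕ.≤ 1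
b2ℕ≤1 true  = ℕ.≤-refl
b2ℕ≤1 false = ℕ.z≤n

⟦⟧*-nonneg : ∀ b {t} → 0ℤ ≤ᶻ t → 0ℤ ≤ᶻ ⟦ b ⟧ * t
⟦⟧*-nonneg true  {t} 0≤t = subst (0ℤ ≤ᶻ_) (sym (*-identityˡ t)) 0≤t
⟦⟧*-nonneg false     _   = ≤-refl

*⟦⟧-nonneg : ∀ {t} b → 0ℤ ≤ᶻ t → 0ℤ ≤ᶻ t * ⟦ b ⟧
*⟦⟧-nonneg {t} true  0≤t = subst (0ℤ ≤ᶻ_) (sym (*-identityʳ t)) 0≤t
*⟦⟧-nonneg {t} false _   = subst (0ℤ ≤ᶻ_) (sym (*-zeroʳ t)) ≤-refl

*⟦⟧≤ : ∀ {t} b → 0ℤ ≤ᶻ t → t * ⟦ b ⟧ ≤ᶻ t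
*⟦⟧≤ {t} true  _   = subst (_≤ᶻ t) (sym (*-identityʳ t)) ≤-refl
*⟦⟧≤ {t} false 0≤t = subst (_≤ᶻ t) (sym (*-zeroʳ t)) 0≤t

[]·-nonneg : ∀ b {t} → 0ℤ ≤ᶻ t → 0ℤ ≤ᶻ [ b ]· t
[]·-nonneg true  0≤t = 0≤t
[]·-nonneg false _   = ≤-refl

[]·-≤ : ∀ b {t} → 0ℤ ≤ᶻ t → [ b ]· t ≤ᶻ t
[]·-≤ true  _   = ≤-refl
[]·-≤ false 0≤t = 0≤t

sq-nonneg : ∀ a → 0ℤ ≤ᶻ sq a
sq-nonneg (+ ℕ.zero)  = ≤-refl
sq-nonneg (+ ℕ.suc n) = +≤+ ℕ.z≤n
sq-nonneg -[1+ n ]    = +≤+ ℕ.z≤n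

sq≡0⇒≡0 : ∀ a → sq a ≡ 0ℤ → a ≡ 0ℤ
sq≡0⇒≡0 a a²≡0 = reduce (i*j≡0⇒i≡0∨j≡0 a a²≡0)

-- The quadratic penalty forcing c = a ∧ b; it vanishes exactly on such triples.
andPenalty : ℤ → ℤ → ℤ → ℤ
andPenalty a b c = a * b - + 2 * a * c - + 2 * b * c + + 3 * c

andPenalty-nonneg : ∀ a b c → 0ℤ ≤ᶻ andPenalty ⟦ a ⟧ ⟦ b ⟧ ⟦ c ⟧
andPenalty-nonneg true  true  true  = +≤+ ℕ.z≤n
andPenalty-nonneg true  true  false = +≤+ ℕ.z≤n
andPenalty-nonneg true  false true  = +≤+ ℕ.z≤n
andPenalty-nonneg true  false false = +≤+ ℕ.z≤n
andPenalty-nonneg false true  true  = +≤+ ℕ.z≤n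
andPenalty-nonneg false true  false = +≤+ ℕ.z≤n
andPenalty-nonneg false false true  = +≤+ ℕ.z≤n
andPenalty-nonneg false false false = +≤+ ℕ.z≤n

andPenalty²-nonneg : ∀ a b c d e →
  0ℤ ≤ᶻ andPenalty ⟦ a ⟧ ⟦ b ⟧ ⟦ c ⟧ + ⟦ a ⟧ * ⟦ d ⟧ - + 2 * ⟦ a ⟧ * ⟦ e ⟧
                                    - + 2 * ⟦ d ⟧ * ⟦ e ⟧ + + 3 * ⟦ e ⟧
andPenalty²-nonneg a b c d e =
  subst (0ℤ ≤ᶻ_) (sym (reassoc (andPenalty ⟦ a ⟧ ⟦ b ⟧ ⟦ c ⟧) (⟦ a ⟧ * ⟦ d ⟧)
                               (+ 2 * ⟦ a ⟧ * ⟦ e ⟧) (+ 2 * ⟦ d ⟧ * ⟦ e ⟧) (+ 3 * ⟦ e ⟧)))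
    (+-mono-≤ (andPenalty-nonneg a b c) (andPenalty-nonneg a d e))
  where
  reassoc : ∀ g p q r s → g + p - q - r + s ≡ g + (p - q - r + s)
  reassoc = solve-∀

+≡0⇒≡0 : ∀ {a b} → 0ℤ ≤ᶻ a → 0ℤ ≤ᶻ b → a + b ≡ 0ℤ → a ≡ 0ℤ × b ≡ 0ℤ
+≡0⇒≡0 {a} {b} 0≤a 0≤b a+b≡0 =
    ≤-antisym (subst (a ≤ᶻ_) a+b≡0 (i≤i+j a b {{nonNegative 0≤b}})) 0≤a
  , ≤-antisym (subst (b ≤ᶻ_) a+b≡0 (i≤j+i b a {{nonNegative 0≤a}})) 0≤b

-+-distrib : ∀ m n → - + (m ℕ.+ n) ≡ - + m - + n
-+-distrib m n = neg-distrib-+ (+ m) (+ n)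

*-lower : ∀ k {a x} → - + a ≤ᶻ x → - + (k ℕ.* a) ≤ᶻ + k * x
*-lower k {a} a≤x = subst (_≤ᶻ + k * _) k*-a≡-ka (*-monoˡ-≤-nonNeg (+ k) a≤x)
  where
  k*-a≡-ka : + k * - + a ≡ - + (k ℕ.* a)
  k*-a≡-ka = trans (sym (neg-distribʳ-* (+ k) (+ a))) (cong -_ (sym (pos-* k a)))

+-lower : ∀ {a b c x y} → - + a ≤ᶻ x → - + b ≤ᶻ y → a ℕ.+ b ℕ.< c → - + c <ᶻ x + y
+-lower {a} {b} a≤x b≤y a+b<c =
  <-≤-trans (neg-mono-< (+<+ a+b<c))
            (subst (_≤ᶻ _) (sym (-+-distrib a b)) (+-mono-≤ a≤x b≤y))

+k≤+k*+[1+n] : ∀ k n → + k ≤ᶻ + k * + ℕ.suc n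
+k≤+k*+[1+n] k n = subst (+ k ≤ᶻ_) (pos-* k (ℕ.suc n)) (+≤+ (ℕ.m≤m*n k (ℕ.suc n)))

k*s+r≡0⇒s≡0×r≡0 : ∀ k {s r} → + k * s + r ≡ 0ℤ → 0ℤ ≤ᶻ s → - + k <ᶻ r → s ≡ 0ℤ × r ≡ 0ℤ
k*s+r≡0⇒s≡0×r≡0 k {+ ℕ.zero}  {r} k0+r≡0 _ _ =
  refl , trans (sym (trans (cong (_+ r) (*-zeroʳ (+ k))) (+-identityˡ r))) k0+r≡0
k*s+r≡0⇒s≡0×r≡0 k {+ ℕ.suc n} {r} ks+r≡0 _ -k<r =
  ⊥-elim (<-irrefl refl (subst (0ℤ <ᶻ_) ks+r≡0 0<ks+r))
  where
  0<ks+r : 0ℤ <ᶻ + k * + ℕ.suc n + r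
  0<ks+r = <-≤-trans (subst (_<ᶻ + k + r) (+-inverseʳ (+ k)) (+-monoʳ-< (+ k) -k<r))
                     (+-monoˡ-≤ r (+k≤+k*+[1+n] k n))

multiple-≡0 : ∀ k p {q} → q ≡ - (+ k * p) → - + k <ᶻ q → q <ᶻ + k → q ≡ 0ℤ
multiple-≡0 k (+ ℕ.zero)  q≡-kp _    _   = trans q≡-kp (cong -_ (*-zeroʳ (+ k)))
multiple-≡0 k (+ ℕ.suc n) refl  -k<q _   =
  contradiction -k<q (≤⇒≯ (neg-mono-≤ (+k≤+k*+[1+n] k n)))
multiple-≡0 k -[1+ n ]    refl  _    q<k =
  contradiction q<k (≤⇒≯ (subst (+ k ≤ᶻ_) (sym (neg-distribʳ-* (+ k) -[1+ n ])) (+k≤+k*+[1+n] k n)))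

Σ-cong : ∀ {n} {f g : Fin n → ℤ} → (∀ i → f i ≡ g i) → Σ f ≡ Σ g
Σ-cong {ℕ.zero}  f≗g = refl
Σ-cong {ℕ.suc n} f≗g = cong₂ _+_ (f≗g zero) (Σ-cong (f≗g ∘ suc))

Σ-mono : ∀ {n} {f g : Fin n → ℤ} → (∀ i → f i ≤ᶻ g i) → Σ f ≤ᶻ Σ g
Σ-mono {ℕ.zero}  f≤g = ≤-refl
Σ-mono {ℕ.suc n} f≤g = +-mono-≤ (f≤g zero) (Σ-mono (f≤g ∘ suc))

Σ-nonneg : ∀ {n} {f : Fin n → ℤ} → (∀ i → 0ℤ ≤ᶻ f i) → 0ℤ ≤ᶻ Σ f
Σ-nonneg {ℕ.zero}  0≤f = ≤-refl
Σ-nonneg {ℕ.suc n} 0≤f = +-mono-≤ (0≤f zero) (Σ-nonneg (0≤f ∘ suc))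

Σ-lower : ∀ {n} {f : Fin n → ℤ} k → (∀ i → - + k ≤ᶻ f i) → - + (n ℕ.* k) ≤ᶻ Σ f
Σ-lower {ℕ.zero}  k -k≤f = ≤-refl
Σ-lower {ℕ.suc n} k -k≤f = subst (_≤ᶻ _) (sym (-+-distrib k (n ℕ.* k)))
  (+-mono-≤ (-k≤f zero) (Σ-lower k (-k≤f ∘ suc)))

Σ≡0⇒≡0 : ∀ {n} {f : Fin n → ℤ} → (∀ i → 0ℤ ≤ᶻ f i) → Σ f ≡ 0ℤ → ∀ i → f i ≡ 0ℤ
Σ≡0⇒≡0 {ℕ.suc n} 0≤f Σf≡0 zero    = proj₁ (+≡0⇒≡0 (0≤f zero) (Σ-nonneg (0≤f ∘ suc)) Σf≡0)
Σ≡0⇒≡0 {ℕ.suc n} 0≤f Σf≡0 (suc i) =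
  Σ≡0⇒≡0 (0≤f ∘ suc) (proj₂ (+≡0⇒≡0 (0≤f zero) (Σ-nonneg (0≤f ∘ suc)) Σf≡0)) i

Σ-neg : ∀ {n} (f : Fin n → ℤ) → Σ (λ i → - f i) ≡ - Σ f
Σ-neg {ℕ.zero}  f = refl
Σ-neg {ℕ.suc n} f = trans (cong (_+_ (- f zero)) (Σ-neg (f ∘ suc))) (sym (neg-distrib-+ (f zero) _))

Σ+≡+sumℕ : ∀ {n} (f : Fin n → ℕ) → Σ (λ i → + f i) ≡ + sumℕ f
Σ+≡+sumℕ {ℕ.zero}  f = refl
Σ+≡+sumℕ {ℕ.suc n} f = cong (_+_ (+ f zero)) (Σ+≡+sumℕ (f ∘ suc))

Σ⟦⟧≡+sumℕ : ∀ {n} (b : Fin n → Bool) → Σ (λ i → ⟦ b i ⟧) ≡ + sumℕ (λ i → b2ℕ (b i))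
Σ⟦⟧≡+sumℕ b = trans (Σ-cong (⟦⟧≡+b2ℕ ∘ b)) (Σ+≡+sumℕ (b2ℕ ∘ b))

Σ≡sum : ∀ {n} (f : Fin n → ℤ) → Σ f ≡ sum f
Σ≡sum {ℕ.zero}  f = refl
Σ≡sum {ℕ.suc n} f = cong (_+_ (f zero)) (Σ≡sum (f ∘ suc))

ΣΣ≡sumsum : ∀ {m n} (f : Fin m → Fin n → ℤ) → Σ (λ i → Σ (f i)) ≡ sum (λ i → sum (f i))
ΣΣ≡sumsum f = trans (Σ≡sum (λ i → Σ (f i))) (sum-cong-≗ (λ i → Σ≡sum (f i)))

Σ-comm : ∀ {m n} (f : Fin m → Fin n → ℤ) → Σ (λ i → Σ (f i)) ≡ Σ (λ j → Σ (λ i → f i j))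
Σ-comm f = trans (ΣΣ≡sumsum f) (trans (∑-comm f) (sym (ΣΣ≡sumsum (λ j i → f i j))))

Σ-distribˡ : ∀ {n} c (f : Fin n → ℤ) → Σ (λ i → c * f i) ≡ c * Σ f
Σ-distribˡ c f =
  trans (Σ≡sum (λ i → c * f i)) (trans (sym (*-distribˡ-sum c f)) (cong (c *_) (sym (Σ≡sum f))))

Σ-init-last : ∀ {n} (f : Fin (ℕ.suc n) → ℤ) → Σ f ≡ Σ (f ∘ inject₁) + f (fromℕ n)
Σ-init-last {n} f =
  trans (Σ≡sum f) (trans (sum-init-last f) (cong (_+ f (fromℕ n)) (sym (Σ≡sum (f ∘ inject₁)))))

Σ-bilinear-≤ : ∀ {m n} (w : Fin n → Fin n → ℤ) (a : Fin m → Fin n → ℤ) →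
  (∀ j k → 0ℤ ≤ᶻ w j k) → (∀ i j → 0ℤ ≤ᶻ a i j) → (∀ j → Σ (λ i → a i j) ≤ᶻ + 1) →
  Σ (λ i → Σ (λ l → Σ (λ j → Σ (λ k → w j k * a i j * a l k)))) ≤ᶻ Σ (λ j → Σ (λ k → w j k))
Σ-bilinear-≤ {m} {n} w a 0≤w 0≤a col≤1 = begin
  Σ (λ i → Σ (λ l → Σ (λ j → Σ (λ k → u i l j k))))
    ≡⟨ Σ-cong (λ i → Σ-comm (λ l j → Σ (u i l j))) ⟩
  Σ (λ i → Σ (λ j → Σ (λ l → Σ (λ k → u i l j k))))
    ≡⟨ Σ-cong (λ i → Σ-cong (λ j → Σ-comm (λ l k → u i l j k))) ⟩
  Σ (λ i → Σ (λ j → Σ (λ k → Σ (λ l → u i l j k))))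
    ≡⟨ Σ-comm (λ i j → Σ (λ k → Σ (λ l → u i l j k))) ⟩
  Σ (λ j → Σ (λ i → Σ (λ k → Σ (λ l → u i l j k))))
    ≡⟨ Σ-cong (λ j → Σ-comm (λ i k → Σ (λ l → u i l j k))) ⟩
  Σ (λ j → Σ (λ k → Σ (λ i → Σ (λ l → u i l j k))))
    ≤⟨ Σ-mono (λ j → Σ-mono (λ k → inner j k)) ⟩
  Σ (λ j → Σ (λ k → w j k)) ∎
  where
  open Data.Integer.Properties.≤-Reasoning
  u : Fin m → Fin m → Fin n → Fin n → ℤ
  u i l j k = w j k * a i j * a l k
  c≤1⇒*≤ : ∀ {c t} → 0ℤ ≤ᶻ c → t ≤ᶻ + 1 → c * t ≤ᶻ c
  c≤1⇒*≤ {c} 0≤c t≤1 = subst (c * _ ≤ᶻ_) (*-identityʳ c) (*-monoˡ-≤-nonNeg c {{nonNegative 0≤c}} t≤1)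
  inner : ∀ j k → Σ (λ i → Σ (λ l → u i l j k)) ≤ᶻ w j k
  inner j k = begin
    Σ (λ i → Σ (λ l → w j k * a i j * a l k)) ≡⟨ Σ-cong (λ i → Σ-distribˡ (w j k * a i j) (λ l → a l k)) ⟩
    Σ (λ i → w j k * a i j * Σ (λ l → a l k)) ≤⟨ Σ-mono (λ i → c≤1⇒*≤ (0≤wa i) (col≤1 k)) ⟩
    Σ (λ i → w j k * a i j)                   ≡⟨ Σ-distribˡ (w j k) (λ i → a i j) ⟩
    w j k * Σ (λ i → a i j)                   ≤⟨ c≤1⇒*≤ (0≤w j k) (col≤1 j) ⟩
    w j k                                     ∎
    where
    0≤wa : ∀ i → 0ℤ ≤ᶻ w j k * a i j
    0≤wa i = subst (_≤ᶻ w j k * a i j) (*-zeroʳ (w j k))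
                   (*-monoˡ-≤-nonNeg (w j k) {{nonNegative (0≤w j k)}} (0≤a i j))

sumℕ-≤ : ∀ {n} {f : Fin n → ℕ} c → (∀ i → f i ℕ.≤ c) → sumℕ f ℕ.≤ n ℕ.* c
sumℕ-≤ {ℕ.zero}  c f≤c = ℕ.z≤n
sumℕ-≤ {ℕ.suc n} c f≤c = ℕ.+-mono-≤ (f≤c zero) (sumℕ-≤ c (f≤c ∘ suc))

sumℕ-< : ∀ {n} {f : Fin n → ℕ} c r → (∀ i → f i ℕ.≤ c) → f r ℕ.< c → sumℕ f ℕ.< n ℕ.* c
sumℕ-< c zero    f≤c fr<c = ℕ.+-mono-<-≤ fr<c (sumℕ-≤ c (f≤c ∘ suc))
sumℕ-< c (suc r) f≤c fr<c = ℕ.+-mono-≤-< (f≤c zero) (sumℕ-< c r (f≤c ∘ suc) fr<c)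

outdeg≤n : ∀ {n} (E : Graph n) j → outdeg E j ℕ.≤ n
outdeg≤n {n} E j = subst (outdeg E j ℕ.≤_) (ℕ.*-identityʳ n) (sumℕ-≤ 1 (λ k → b2ℕ≤1 (E j k)))

edgeCount : ∀ {n} → Graph n → ℕ
edgeCount E = sumℕ (indeg E)

Σ⟦E⟧≡+edgeCount : ∀ {n} (E : Graph n) → Σ (λ j → Σ (λ k → ⟦ E j k ⟧)) ≡ + edgeCount E
Σ⟦E⟧≡+edgeCount E = trans (Σ-comm (λ j k → ⟦ E j k ⟧))
  (trans (Σ-cong (λ k → Σ⟦⟧≡+sumℕ (λ j → E j k))) (Σ+≡+sumℕ (indeg E)))

module PhyloNetwork {n p} {E : Graph n} {lab : Fin p → Fin n} (N : IsPhyloNetwork E lab) where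
  open IsPhyloNetwork N

  degrees≤2 : ∀ j → indeg E j ℕ.≤ 2 × outdeg E j ℕ.≤ 2
  degrees≤2 j with j ≟ root
  ... | yes refl rewrite root-indeg | root-outdeg = ℕ.z≤n , ℕ.≤-refl
  ... | no j≢root with degrees j j≢root
  ...   | inj₁ (in≡1 , out≡0)        rewrite in≡1 | out≡0 = ℕ.s≤s ℕ.z≤n , ℕ.z≤n
  ...   | inj₂ (inj₁ (in≡1 , out≡2)) rewrite in≡1 | out≡2 = ℕ.s≤s ℕ.z≤n , ℕ.≤-refl
  ...   | inj₂ (inj₂ (in≡2 , out≡1)) rewrite in≡2 | out≡1 = ℕ.≤-refl , ℕ.s≤s ℕ.z≤n

  2≤n : 2 ℕ.≤ n
  2≤n = subst (ℕ._≤ n) root-outdeg (outdeg≤n E root)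

  -- The root contributes in-degree 0 < 2.
  edgeCount<2n : edgeCount E ℕ.< 2 ℕ.* n
  edgeCount<2n = subst (edgeCount E ℕ.<_) (ℕ.*-comm n 2)
    (sumℕ-< 2 root (proj₁ ∘ degrees≤2) (subst (ℕ._< 2) (sym root-indeg) (ℕ.s≤s ℕ.z≤n)))

tree-edge-term-≥ : ∀ b c {d} → 0ℤ ≤ᶻ d → - d ≤ᶻ [ b ]· (⟦ c ⟧ * (+ 1 - d))
tree-edge-term-≥ false c     0≤d = neg-mono-≤ 0≤d
tree-edge-term-≥ true  false 0≤d = neg-mono-≤ 0≤d
tree-edge-term-≥ true  true  {d} _ = subst (- d ≤ᶻ_) (sym (*-identityˡ (+ 1 - d))) (i≤j+i (- d) (+ 1))

tree-edge-term-≤ : ∀ b c {d} → 0ℤ ≤ᶻ d → [ b ]· (⟦ c ⟧ * (+ 1 - d)) ≤ᶻ ⟦ c ⟧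
tree-edge-term-≤ false c     _   = ⟦⟧-nonneg c
tree-edge-term-≤ true  false _   = ≤-refl
tree-edge-term-≤ true  true  {d} 0≤d =
  subst (_≤ᶻ + 1) (sym (*-identityˡ (+ 1 - d))) (i-j≤i (+ 1) d {{nonNegative 0≤d}})

⟦⟧*[1-c]≥-1 : ∀ b {c} → c ≤ᶻ + 2 → - + 1 ≤ᶻ ⟦ b ⟧ * (+ 1 - c)
⟦⟧*[1-c]≥-1 true  {c} c≤2 =
  subst (- + 1 ≤ᶻ_) (sym (*-identityˡ (+ 1 - c))) (+-monoʳ-≤ (+ 1) (neg-mono-≤ c≤2))
⟦⟧*[1-c]≥-1 false     _   = -≤+

module PenaltyBounds {nN nT s} (EN : Graph nN) (ET : Graph nT)
                     (ℓ : Fin nT → Fin nN) (v : Vars nT nN s) where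
  open QUBO EN ET ℓ v
  open Vars v
  open Data.Integer.Properties.≤-Reasoning

  xᵢ : Fin nT → Fin nN → Bool
  xᵢ i = x (inject₁ i)

  constraintPenalty : ℤ
  constraintPenalty = P₁ + P₂ + P₃ + P₄ + P₅ + P₆ + P₇ + P₈ + P₉ + P₁₀

  P₁-nonneg : 0ℤ ≤ᶻ P₁
  P₁-nonneg = +-mono-≤ (sq-nonneg (+ 1 - Σ (λ j → ⟦ x zero j ⟧))) (Σ-nonneg λ i → []·-nonneg _
    (sq-nonneg (+ 1 - Σ (X i) + Σ (λ r → + (2 ℕ.^ toℕ r) * ⟦ y i r ⟧))))

  P₂-nonneg : 0ℤ ≤ᶻ P₂
  P₂-nonneg = Σ-nonneg λ j → sq-nonneg (Σ (λ i → ⟦ x i j ⟧) - + 1)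

  P₃-nonneg : 0ℤ ≤ᶻ P₃
  P₃-nonneg = Σ-nonneg λ i → Σ-nonneg λ j →
    []·-nonneg (tree j) (andPenalty-nonneg (xᵢ i (j₁ j)) (xᵢ i (j₂ j)) (z i j))

  P₄-nonneg : 0ℤ ≤ᶻ P₄
  P₄-nonneg = Σ-nonneg λ i → Σ-nonneg λ j → []·-nonneg (tree j) (*⟦⟧-nonneg (z i j) (⟦⟧-nonneg (xᵢ i j)))

  P₅-nonneg : 0ℤ ≤ᶻ P₅
  P₅-nonneg = Σ-nonneg λ i → Σ-nonneg λ j →
    []·-nonneg (ret j) (andPenalty-nonneg (xᵢ i (j¹ j)) (xᵢ i (j² j)) (z i j))

  P₆-nonneg : 0ℤ ≤ᶻ P₆
  P₆-nonneg = Σ-nonneg λ i → Σ-nonneg λ j → []·-nonneg (ret j) (*⟦⟧-nonneg (z i j) (⟦⟧-nonneg (xᵢ i j)))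

  P₇-nonneg : 0ℤ ≤ᶻ P₇
  P₇-nonneg = Σ-nonneg λ i → Σ-nonneg λ l → []·-nonneg (neq l i) (⟦⟧*-nonneg (ET i l)
    (Σ-nonneg λ j → []·-nonneg (tree j) (*⟦⟧-nonneg (z l j) (⟦⟧-nonneg (xᵢ i j)))))

  P₈-nonneg : 0ℤ ≤ᶻ P₈
  P₈-nonneg = Σ-nonneg λ i → []·-nonneg _ (Σ-nonneg λ j → []·-nonneg (tree j)
    (andPenalty²-nonneg (xᵢ i j) (xᵢ i (j₁ j)) (zh₀ i j) (xᵢ i (j₂ j)) (zh₁ i j)))

  P₉-nonneg : 0ℤ ≤ᶻ P₉
  P₉-nonneg = Σ-nonneg λ i → Σ-nonneg λ l → []·-nonneg (neq l i) (⟦⟧*-nonneg (ET i l)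
    (Σ-nonneg λ j → []·-nonneg (tree j) (+-mono-≤ (*⟦⟧-nonneg (xᵢ l (j₂ j)) (⟦⟧-nonneg (zh₀ i j)))
                                                  (*⟦⟧-nonneg (xᵢ l (j₁ j)) (⟦⟧-nonneg (zh₁ i j))))))

  P₁₀-nonneg : 0ℤ ≤ᶻ P₁₀
  P₁₀-nonneg = Σ-nonneg λ i → []·-nonneg (isLeaf ET i) (sq-nonneg (+ 1 - X i (ℓ i)))

  otherPenalties : ℤ
  otherPenalties = P₁ + P₃ + P₄ + P₅ + P₆ + P₇ + P₈ + P₉ + P₁₀

  otherPenalties-nonneg : 0ℤ ≤ᶻ otherPenalties
  otherPenalties-nonneg =
    +-mono-≤ (+-mono-≤ (+-mono-≤ (+-mono-≤ (+-mono-≤ (+-mono-≤ (+-mono-≤ (+-mono-≤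
      P₁-nonneg P₃-nonneg) P₄-nonneg) P₅-nonneg) P₆-nonneg) P₇-nonneg) P₈-nonneg) P₉-nonneg) P₁₀-nonneg

  constraintPenalty≡P₂+others : constraintPenalty ≡ P₂ + otherPenalties
  constraintPenalty≡P₂+others = move-second P₁ P₂ P₃ P₄ P₅ P₆ P₇ P₈ P₉ P₁₀
    where
    move-second : ∀ a b c d e f g h i j →
      a + b + c + d + e + f + g + h + i + j ≡ b + (a + c + d + e + f + g + h + i + j)
    move-second = solve-∀

  constraintPenalty-nonneg : 0ℤ ≤ᶻ constraintPenalty
  constraintPenalty-nonneg =
    subst (0ℤ ≤ᶻ_) (sym constraintPenalty≡P₂+others) (+-mono-≤ P₂-nonneg otherPenalties-nonneg)

  constraintPenalty≡0⇒P₂≡0 : constraintPenalty ≡ 0ℤ → P₂ ≡ 0ℤ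
  constraintPenalty≡0⇒P₂≡0 ≡0 =
    proj₁ (+≡0⇒≡0 P₂-nonneg otherPenalties-nonneg (trans (sym constraintPenalty≡P₂+others) ≡0))

  P₂≡0⇒columns≤1 : P₂ ≡ 0ℤ → ∀ j → Σ (λ i → X i j) ≤ᶻ + 1
  P₂≡0⇒columns≤1 P₂≡0 j = begin
    Σ (λ i → X i j)                               ≤⟨ i≤i+j _ _ {{nonNegative (⟦⟧-nonneg (x (fromℕ nT) j))}} ⟩
    Σ (λ i → X i j) + ⟦ x (fromℕ nT) j ⟧          ≡⟨ sym (Σ-init-last (λ i → ⟦ x i j ⟧)) ⟩
    Σ (λ i → ⟦ x i j ⟧)                           ≡⟨ i-j≡0⇒i≡j _ _ (sq≡0⇒≡0 _ column-penalty≡0) ⟩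
    + 1                                           ∎
    where
    column-penalty≡0 : sq (Σ (λ i → ⟦ x i j ⟧) - + 1) ≡ 0ℤ
    column-penalty≡0 = Σ≡0⇒≡0 (λ j → sq-nonneg (Σ (λ i → ⟦ x i j ⟧) - + 1)) P₂≡0 j

  P₁₁-lower : (∀ j → outdeg EN j ℕ.≤ 2) → - + (nT ℕ.* nN ℕ.+ nT) ≤ᶻ P₁₁
  P₁₁-lower outdeg≤2 = begin
    - + (nT ℕ.* nN ℕ.+ nT)            ≡⟨ -+-distrib (nT ℕ.* nN) nT ⟩
    - + (nT ℕ.* nN) - + nT            ≡⟨ cong (λ m → - + (nT ℕ.* m) - + nT) (sym (ℕ.*-identityʳ nN)) ⟩
    - + (nT ℕ.* (nN ℕ.* 1)) - + nT    ≤⟨ +-monoˡ-≤ (- + nT) (Σ-lower _ λ i → Σ-lower 1 λ j →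
                                           ⟦⟧*[1-c]≥-1 (xᵢ i j) (successors≤2 i j)) ⟩
    P₁₁                               ∎
    where
    successors≤2 : ∀ i j → Σ (λ k → [ neq k j ]· (G j k * X i k)) ≤ᶻ + 2
    successors≤2 i j = begin
      Σ (λ k → [ neq k j ]· (G j k * X i k)) ≤⟨ Σ-mono GX≤G ⟩
      Σ (λ k → G j k)                        ≡⟨ Σ⟦⟧≡+sumℕ (EN j) ⟩
      + outdeg EN j                          ≤⟨ +≤+ (outdeg≤2 j) ⟩
      + 2                                    ∎
      where
      GX≤G : ∀ k → [ neq k j ]· (G j k * X i k) ≤ᶻ G j k
      GX≤G k = ≤-trans ([]·-≤ (neq k j) (*⟦⟧-nonneg (xᵢ i k) (⟦⟧-nonneg (EN j k))))
                       (*⟦⟧≤ (xᵢ i k) (⟦⟧-nonneg (EN j k)))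

  imageEdges : Fin nT → Fin nT → ℤ
  imageEdges i l = Σ (λ j → Σ (λ k → [ neq k j ]· (G j k * X i j * X l k)))

  GXX-nonneg : ∀ i l j k → 0ℤ ≤ᶻ G j k * X i j * X l k
  GXX-nonneg i l j k = *⟦⟧-nonneg (xᵢ l k) (*⟦⟧-nonneg (xᵢ i j) (⟦⟧-nonneg (EN j k)))

  imageEdges-nonneg : ∀ i l → 0ℤ ≤ᶻ imageEdges i l
  imageEdges-nonneg i l = Σ-nonneg λ j → Σ-nonneg λ k → []·-nonneg (neq k j) (GXX-nonneg i l j k)

  imageEdges≤edgeCount : ∀ i l → imageEdges i l ≤ᶻ + edgeCount EN
  imageEdges≤edgeCount i l = begin
    imageEdges i l               ≤⟨ Σ-mono (λ j → Σ-mono (λ k → GXX≤G j k)) ⟩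
    Σ (λ j → Σ (λ k → G j k))    ≡⟨ Σ⟦E⟧≡+edgeCount EN ⟩
    + edgeCount EN               ∎
    where
    GXX≤G : ∀ j k → [ neq k j ]· (G j k * X i j * X l k) ≤ᶻ G j k
    GXX≤G j k = ≤-trans ([]·-≤ (neq k j) (GXX-nonneg i l j k))
                (≤-trans (*⟦⟧≤ (xᵢ l k) (*⟦⟧-nonneg (xᵢ i j) (⟦⟧-nonneg (EN j k))))
                         (*⟦⟧≤ (xᵢ i j) (⟦⟧-nonneg (EN j k))))

  P₁₂-lower : - + (nT ℕ.* (nT ℕ.* edgeCount EN)) ≤ᶻ P₁₂
  P₁₂-lower = Σ-lower _ λ i → Σ-lower _ λ l →
    ≤-trans (neg-mono-≤ (imageEdges≤edgeCount i l)) (tree-edge-term-≥ (neq l i) (ET i l) (imageEdges-nonneg i l))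

  P₁₂-upper : P₁₂ ≤ᶻ + edgeCount ET
  P₁₂-upper = begin
    P₁₂                          ≤⟨ Σ-mono (λ i → Σ-mono (λ l →
                                      tree-edge-term-≤ (neq l i) (ET i l) (imageEdges-nonneg i l))) ⟩
    Σ (λ i → Σ (λ l → F i l))    ≡⟨ Σ⟦E⟧≡+edgeCount ET ⟩
    + edgeCount ET               ∎

  -- With at most one i per column, each edge of N is counted by at most one pair (i, l).
  P₁₂-lower-columns : (∀ j → Σ (λ i → X i j) ≤ᶻ + 1) → - + edgeCount EN ≤ᶻ P₁₂
  P₁₂-lower-columns columns≤1 = begin
    - + edgeCount EN                         ≡⟨ cong -_ (sym (Σ⟦E⟧≡+edgeCount EN)) ⟩
    - Σ (λ j → Σ (λ k → G j k))              ≤⟨ neg-mono-≤ Σimages≤ΣG ⟩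
    - Σ (λ i → Σ (λ l → imageEdges i l))     ≡⟨ sym Σ-neg² ⟩
    Σ (λ i → Σ (λ l → - imageEdges i l))     ≤⟨ Σ-mono (λ i → Σ-mono (λ l →
                                                  tree-edge-term-≥ (neq l i) (ET i l) (imageEdges-nonneg i l))) ⟩
    P₁₂                                      ∎
    where
    Σ-neg² : Σ (λ i → Σ (λ l → - imageEdges i l)) ≡ - Σ (λ i → Σ (λ l → imageEdges i l))
    Σ-neg² = trans (Σ-cong (λ i → Σ-neg (imageEdges i))) (Σ-neg (λ i → Σ (imageEdges i)))
    Σimages≤ΣG : Σ (λ i → Σ (λ l → imageEdges i l)) ≤ᶻ Σ (λ j → Σ (λ k → G j k))
    Σimages≤ΣG = ≤-trans
      (Σ-mono λ i → Σ-mono λ l → Σ-mono λ j → Σ-mono λ k → []·-≤ (neq k j) (GXX-nonneg i l j k))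
      (Σ-bilinear-≤ G X (λ j k → ⟦⟧-nonneg (EN j k)) (λ i j → ⟦⟧-nonneg (xᵢ i j)) columns≤1)

-- The factor 3 + 3a + 3b + 2ab is 2nm − n − m − 1 for n = 2 + b and m = 2 + a.
penalty-weight-dominates : ∀ {m n e} → 2 ℕ.≤ m → 2 ℕ.≤ n → e ℕ.≤ 2 ℕ.* n →
  2 ℕ.* n ℕ.* (m ℕ.* n ℕ.+ m) ℕ.+ m ℕ.* (m ℕ.* e) ℕ.< 4 ℕ.* n ℕ.* n ℕ.* m ℕ.* m
penalty-weight-dominates {ℕ.suc (ℕ.suc a)} {ℕ.suc (ℕ.suc b)} {e}
                         (ℕ.s≤s (ℕ.s≤s _)) (ℕ.s≤s (ℕ.s≤s _)) e≤2n =
  begin-strict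
    2 ℕ.* n ℕ.* (m ℕ.* n ℕ.+ m) ℕ.+ m ℕ.* (m ℕ.* e)
      ≤⟨ ℕ.+-monoʳ-≤ (2 ℕ.* n ℕ.* (m ℕ.* n ℕ.+ m)) (ℕ.*-monoʳ-≤ m (ℕ.*-monoʳ-≤ m e≤2n)) ⟩
    2 ℕ.* n ℕ.* (m ℕ.* n ℕ.+ m) ℕ.+ m ℕ.* (m ℕ.* (2 ℕ.* n))
      <⟨ ℕ.m<m+n _ (ℕ.s≤s ℕ.z≤n) ⟩
    2 ℕ.* n ℕ.* (m ℕ.* n ℕ.+ m) ℕ.+ m ℕ.* (m ℕ.* (2 ℕ.* n))
      ℕ.+ 2 ℕ.* n ℕ.* m ℕ.* (3 ℕ.+ 3 ℕ.* a ℕ.+ 3 ℕ.* b ℕ.+ 2 ℕ.* a ℕ.* b)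
      ≡⟨ identity a b ⟩
    4 ℕ.* n ℕ.* n ℕ.* m ℕ.* m
      ∎
  where
  open ℕ.≤-Reasoning
  m n : ℕ
  m = 2 ℕ.+ a
  n = 2 ℕ.+ b
  identity : ∀ a b →
    2 ℕ.* (2 ℕ.+ b) ℕ.* ((2 ℕ.+ a) ℕ.* (2 ℕ.+ b) ℕ.+ (2 ℕ.+ a))
      ℕ.+ (2 ℕ.+ a) ℕ.* ((2 ℕ.+ a) ℕ.* (2 ℕ.* (2 ℕ.+ b)))
      ℕ.+ 2 ℕ.* (2 ℕ.+ b) ℕ.* (2 ℕ.+ a) ℕ.* (3 ℕ.+ 3 ℕ.* a ℕ.+ 3 ℕ.* b ℕ.+ 2 ℕ.* a ℕ.* b)
    ≡ 4 ℕ.* (2 ℕ.+ b) ℕ.* (2 ℕ.+ b) ℕ.* (2 ℕ.+ a) ℕ.* (2 ℕ.+ a)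
  identity = ℕ-Solver.solve-∀

lemma19 : ∀ {p nN nT : ℕ}
              (EN : Graph nN) (labN : Fin p → Fin nN) → IsPhyloNetwork EN labN →
              (ET : Graph nT) (labT : Fin p → Fin nT) → IsPhyloTree ET labT →
              nT ≤ nN →
              (ℓ : Fin nT → Fin nN) → (∀ a → ℓ (labT a) ≡ labN a) →
              (v : Vars nT nN (sOf nN nT)) →
              QUBO.H EN ET ℓ v ≡ + 0 →
              QUBO.P₁₂ EN ET ℓ v ≡ + 0
lemma19 {nN = nN} {nT} EN _ isNetwork ET _ isTree nT≤nN ℓ _ v H≡0 =
  multiple-≡0 (2 ℕ.* nN) P₁₁ (inverseʳ-unique (A * P₁₁) P₁₂ A*P₁₁+P₁₂≡0) -A<P₁₂ P₁₂<A
  where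
  open QUBO EN ET ℓ v
  open PenaltyBounds EN ET ℓ v
  module N = PhyloNetwork isNetwork
  module T = PhyloNetwork (IsPhyloTree.network isTree)

  -B<A*P₁₁+P₁₂ : - B <ᶻ A * P₁₁ + P₁₂
  -B<A*P₁₁+P₁₂ = +-lower (*-lower (2 ℕ.* nN) (P₁₁-lower (proj₂ ∘ N.degrees≤2))) P₁₂-lower
                         (penalty-weight-dominates T.2≤n N.2≤n (ℕ.<⇒≤ N.edgeCount<2n))

  S≡0×A*P₁₁+P₁₂≡0 : constraintPenalty ≡ 0ℤ × A * P₁₁ + P₁₂ ≡ 0ℤ
  S≡0×A*P₁₁+P₁₂≡0 = k*s+r≡0⇒s≡0×r≡0 (4 ℕ.* nN ℕ.* nN ℕ.* nT ℕ.* nT)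
    (trans (sym (+-assoc (B * constraintPenalty) (A * P₁₁) P₁₂)) H≡0) constraintPenalty-nonneg -B<A*P₁₁+P₁₂

  A*P₁₁+P₁₂≡0 : A * P₁₁ + P₁₂ ≡ 0ℤ
  A*P₁₁+P₁₂≡0 = proj₂ S≡0×A*P₁₁+P₁₂≡0

  -A<P₁₂ : - A <ᶻ P₁₂
  -A<P₁₂ = <-≤-trans (neg-mono-< (+<+ N.edgeCount<2n))
    (P₁₂-lower-columns (P₂≡0⇒columns≤1 (constraintPenalty≡0⇒P₂≡0 (proj₁ S≡0×A*P₁₁+P₁₂≡0))))

  P₁₂<A : P₁₂ <ᶻ A
  P₁₂<A = ≤-<-trans P₁₂-upper (+<+ (ℕ.<-≤-trans T.edgeCount<2n (ℕ.*-monoʳ-≤ 2 nT≤nN)))
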